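{- Let $G=(U\sqcup V,E)$ be a bipartite graph with $U=\{u_1,\dots,u_n\}$, $V=\{v_1,\dots,v_s\}$, $n\ge s$, and integer weight function $w:E\to\mathbb{Z}$; let $k\in\mathbb{Z}$ be any constant, and let $G_a,w_a$ be as defined in the context. If $N$ is a minimum weight perfect matching of $\{G_a,w_a\}$, then $M=N\cap E$ is an optimum matching of $\{G,w\}$ (a maximum cardinality matching of minimum weight among maximum cardinality matchings) which covers $V$.
   Context: Let $v_{s+1},\dots,v_n$ be new vertices and $V_a=V\cup\{v_{s+1},\dots,v_n\}$. Let $D=\{u_iv_j: u_i\in U,\ v_j\in V_a\setminus V\}$ and $G_a=(U\sqcup V_a,E\cup D)$. The weight $w_a:E\cup D\to\mathbb{Z}$ is $w_a(e)=w(e)$ for $e\in E$ and $w_a(e)=k$ for $e\in D$. The weight of a matching is the sum of its edge weights. -}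

module Defs where

open import Data.Nat using (ℕ; zero; suc; _∸_) renaming (_+_ to _+ℕ_; _≤_ to _≤ℕ_)
open import Data.Integer using (ℤ; _+_; _≤_; 0ℤ)
open import Data.Fin using (Fin; zero; suc; splitAt; _↑ˡ_)
open import Data.Bool using (Bool; true; false; if_then_else_)
open import Data.Sum using (_⊎_; inj₁; inj₂)
open import Data.Product using (∃; _×_)
open import Relation.Binary.PropositionalEquality using (_≡_)

sumℤ : ∀ {m} → (Fin m → ℤ) → ℤ
sumℤ {zero}  f = 0ℤ
sumℤ {suc m} f = f zero + sumℤ (λ i → f (suc i))

sumℕ : ∀ {m} → (Fin m → ℕ) → ℕ
sumℕ {zero}  f = 0
sumℕ {suc m} f = f zero +ℕ sumℕ (λ i → f (suc i))

-- A bipartite graph with parts Fin a (U side) and Fin b (V side) is given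
-- by its edge relation; an edge subset likewise by a Boolean relation.
EdgeSet : ℕ → ℕ → Set
EdgeSet a b = Fin a → Fin b → Bool

_⊆ₑ_ : ∀ {a b} → EdgeSet a b → EdgeSet a b → Set
M ⊆ₑ E = ∀ i j → M i j ≡ true → E i j ≡ true

IsMatching : ∀ {a b} → EdgeSet a b → EdgeSet a b → Set
IsMatching E M =
  (M ⊆ₑ E)
  × (∀ i j j′ → M i j ≡ true → M i j′ ≡ true → j ≡ j′)
  × (∀ i i′ j → M i j ≡ true → M i′ j ≡ true → i ≡ i′)

CoversV : ∀ {a b} → EdgeSet a b → Set
CoversV M = ∀ j → ∃ λ i → M i j ≡ true

CoversU : ∀ {a b} → EdgeSet a b → Set
CoversU M = ∀ i → ∃ λ j → M i j ≡ true

IsPerfectMatching : ∀ {a b} → EdgeSet a b → EdgeSet a b → Set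
IsPerfectMatching E M = IsMatching E M × CoversU M × CoversV M

card : ∀ {a b} → EdgeSet a b → ℕ
card M = sumℕ (λ i → sumℕ (λ j → if M i j then 1 else 0))

-- weight of M w.r.t. w (values of w off the edge set are irrelevant)
weight : ∀ {a b} → (Fin a → Fin b → ℤ) → EdgeSet a b → ℤ
weight w M = sumℤ (λ i → sumℤ (λ j → if M i j then w i j else 0ℤ))

IsMinWeightPerfectMatching : ∀ {a b} → EdgeSet a b → (Fin a → Fin b → ℤ) → EdgeSet a b → Set
IsMinWeightPerfectMatching E w N =
  IsPerfectMatching E N × (∀ N′ → IsPerfectMatching E N′ → weight w N ≤ weight w N′)

IsOptimumMatching : ∀ {a b} → EdgeSet a b → (Fin a → Fin b → ℤ) → EdgeSet a b → Set
IsOptimumMatching E w M =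
  IsMatching E M
  × (∀ M′ → IsMatching E M′ → card M′ ≤ℕ card M)
  × (∀ M′ → IsMatching E M′ → card M′ ≡ card M → weight w M ≤ weight w M′)

-- Augmented graph: V_a = Fin (s + (n ∸ s)); the first s vertices are V
-- (v ↦ v ↑ˡ (n ∸ s)), the remaining n ∸ s are the new vertices v_{s+1..n}.
augE : ∀ n s → EdgeSet n s → EdgeSet n (s +ℕ (n ∸ s))
augE n s E i j with splitAt s j
... | inj₁ v = E i v
... | inj₂ _ = true

augW : ∀ n s → (Fin n → Fin s → ℤ) → ℤ → Fin n → Fin (s +ℕ (n ∸ s)) → ℤ
augW n s w k i j with splitAt s j
... | inj₁ v = w i v
... | inj₂ _ = k

-- N ∩ E, viewed as an edge set of G
restrict : ∀ n s → EdgeSet n (s +ℕ (n ∸ s)) → EdgeSet n s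
restrict n s N i v = N i (v ↑ˡ (n ∸ s))

-- Every vertex v_{s+1}, ..., v_n must be matched by a perfect matching P of G_a, each at cost k, so
-- w_a(P) = w(P ∩ E) + (n − s)k.  As N covers V, M = N ∩ E has |V| = s edges, the largest size a
-- matching of G can have.  Conversely a matching M′ of G with s edges covers V and leaves exactly
-- n − s vertices of U free; matching these bijectively to the new vertices extends M′ to a perfect
-- matching of G_a of weight w(M′) + (n − s)k, which is at least w_a(N) = w(M) + (n − s)k.
module Submission where

open import Defs
open import Data.Nat using (ℕ; _≤_; _+_; _∸_)
open import Data.Integer using (ℤ)
open import Data.Fin using (Fin)
open import Data.Product using (_×_)

open import Algebra.Bundles using (CommutativeMonoid)
import Algebra.Properties.CommutativeMonoid.Sum as MonoidSum
open import Data.Bool using (Bool; true; false; not; if_then_else_)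
import Data.Bool.Properties as Boolₚ
open import Data.Fin using (zero; suc; punchIn; _↑ˡ_; _↑ʳ_; splitAt; _≟_)
import Data.Fin.Properties as Finₚ
open import Data.Integer using (0ℤ; -_) renaming (_+_ to _+ℤ_; _≤_ to _≤ℤ_)
import Data.Integer.Properties as ℤₚ
open import Algebra.Properties.AbelianGroup ℤₚ.+-0-abelianGroup using (//-rightDividesʳ)
open import Data.Nat using (zero; suc; z≤n; s≤s)
import Data.Nat.Properties as ℕₚ
open import Data.Product using (∃; Σ; _,_; proj₁; proj₂; map; map₂)
open import Data.Sum using (_⊎_; inj₁; inj₂; [_,_]′)
open import Data.Vec.Functional using (removeAt)
open import Function using (_∘_; flip)
open import Function.Definitions using (Injective)
open import Relation.Nullary using (Dec; yes; no; does; contradiction)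
open import Relation.Nullary.Decidable using (dec-true; dec-false)
open import Relation.Binary.PropositionalEquality
  using (_≡_; _≢_; refl; sym; trans; cong; cong₂; subst; subst₂; module ≡-Reasoning)

UniquelyTrue : ∀ {m} → (Fin m → Bool) → Set
UniquelyTrue p = ∃ λ i → p i ≡ true × (∀ j → p j ≡ true → j ≡ i)

module _ {c ℓ} (M : CommutativeMonoid c ℓ) where
  open CommutativeMonoid M
    using (_≈_; _∙_; ε; ∙-cong; identityʳ; reflexive; setoid)
    renaming (Carrier to A; refl to ≈-refl; trans to ≈-trans)
  open MonoidSum M using (sum; sum-remove; sum-cong-≋; sum-replicate-zero)
  open import Relation.Binary.Reasoning.Setoid setoid

  sum-if-unique : ∀ {n} {p : Fin n → Bool} x → UniquelyTrue p → sum (λ i → if p i then x else ε) ≈ x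
  sum-if-unique {suc n} {p} x (i , pᵢ , unique) = begin
    sum t                     ≈⟨ sum-remove t ⟩
    t i ∙ sum (removeAt t i)  ≈⟨ ∙-cong (reflexive (cong (λ b → if b then x else ε) pᵢ)) rest≈ε ⟩
    x ∙ ε                     ≈⟨ identityʳ x ⟩
    x                         ∎
    where
    t : Fin (suc n) → A
    t j = if p j then x else ε
    others-vanish : ∀ j → t (punchIn i j) ≈ ε
    others-vanish j with p (punchIn i j) in e
    ... | true  = contradiction (unique _ e) (Finₚ.punchInᵢ≢i i j)
    ... | false = ≈-refl
    rest≈ε : sum (removeAt t i) ≈ ε
    rest≈ε = ≈-trans (sum-cong-≋ others-vanish) (sum-replicate-zero n)

module ∑ℕ = MonoidSum ℕₚ.+-0-commutativeMonoid
module ∑ℤ = MonoidSum ℤₚ.+-0-commutativeMonoid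

sumℕ≡sum : ∀ {m} (f : Fin m → ℕ) → sumℕ f ≡ ∑ℕ.sum f
sumℕ≡sum {zero}  f = refl
sumℕ≡sum {suc m} f = cong (f zero +_) (sumℕ≡sum (f ∘ suc))

sumℤ≡sum : ∀ {m} (f : Fin m → ℤ) → sumℤ f ≡ ∑ℤ.sum f
sumℤ≡sum {zero}  f = refl
sumℤ≡sum {suc m} f = cong (f zero +ℤ_) (sumℤ≡sum (f ∘ suc))

sumℕ-cong : ∀ {m} {f g : Fin m → ℕ} → (∀ i → f i ≡ g i) → sumℕ f ≡ sumℕ g
sumℕ-cong {f = f} {g} f≗g = trans (sumℕ≡sum f) (trans (∑ℕ.sum-cong-≗ f≗g) (sym (sumℕ≡sum g)))

sumℕ-distrib-+ : ∀ {m} (f g : Fin m → ℕ) → sumℕ (λ i → f i + g i) ≡ sumℕ f + sumℕ g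
sumℕ-distrib-+ f g = trans (sumℕ≡sum (λ i → f i + g i))
  (trans (∑ℕ.∑-distrib-+ f g) (sym (cong₂ _+_ (sumℕ≡sum f) (sumℕ≡sum g))))

sumℕ-comm : ∀ {m n} (f : Fin m → Fin n → ℕ) → sumℕ (λ i → sumℕ (f i)) ≡ sumℕ (λ j → sumℕ (λ i → f i j))
sumℕ-comm f = trans (double f) (trans (∑ℕ.∑-comm f) (sym (double (flip f))))
  where
  double : ∀ {m n} (f : Fin m → Fin n → ℕ) → sumℕ (λ i → sumℕ (f i)) ≡ ∑ℕ.sum (λ i → ∑ℕ.sum (f i))
  double f = trans (sumℕ≡sum (λ i → sumℕ (f i))) (∑ℕ.sum-cong-≗ (sumℕ≡sum ∘ f))

sumℤ-cong : ∀ {m} {f g : Fin m → ℤ} → (∀ i → f i ≡ g i) → sumℤ f ≡ sumℤ g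
sumℤ-cong {f = f} {g} f≗g = trans (sumℤ≡sum f) (trans (∑ℤ.sum-cong-≗ f≗g) (sym (sumℤ≡sum g)))

sumℤ-distrib-+ : ∀ {m} (f g : Fin m → ℤ) → sumℤ (λ i → f i +ℤ g i) ≡ sumℤ f +ℤ sumℤ g
sumℤ-distrib-+ f g = trans (sumℤ≡sum (λ i → f i +ℤ g i))
  (trans (∑ℤ.∑-distrib-+ f g) (sym (cong₂ _+ℤ_ (sumℤ≡sum f) (sumℤ≡sum g))))

sumℤ-comm : ∀ {m n} (f : Fin m → Fin n → ℤ) → sumℤ (λ i → sumℤ (f i)) ≡ sumℤ (λ j → sumℤ (λ i → f i j))
sumℤ-comm f = trans (double f) (trans (∑ℤ.∑-comm f) (sym (double (flip f))))
  where
  double : ∀ {m n} (f : Fin m → Fin n → ℤ) → sumℤ (λ i → sumℤ (f i)) ≡ ∑ℤ.sum (λ i → ∑ℤ.sum (f i))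
  double f = trans (sumℤ≡sum (λ i → sumℤ (f i))) (∑ℤ.sum-cong-≗ (sumℤ≡sum ∘ f))

sumℤ-splitAt : ∀ m {n} (f : Fin (m + n) → ℤ) → sumℤ f ≡ sumℤ (λ i → f (i ↑ˡ n)) +ℤ sumℤ (λ j → f (m ↑ʳ j))
sumℤ-splitAt zero    f = sym (ℤₚ.+-identityˡ _)
sumℤ-splitAt (suc m) f = trans (cong (f zero +ℤ_) (sumℤ-splitAt m (f ∘ suc))) (sym (ℤₚ.+-assoc (f zero) _ _))

sumℤ-if-unique : ∀ {m} {p : Fin m → Bool} x → UniquelyTrue p → sumℤ (λ i → if p i then x else 0ℤ) ≡ x
sumℤ-if-unique {p = p} x u = trans (sumℤ≡sum (λ i → if p i then x else 0ℤ)) (sum-if-unique ℤₚ.+-0-commutativeMonoid x u)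

sumℕ-ones : ∀ m → sumℕ {m} (λ _ → 1) ≡ m
sumℕ-ones zero    = refl
sumℕ-ones (suc m) = cong suc (sumℕ-ones m)

sumℕ-bounded : ∀ {m} (f : Fin m → ℕ) → (∀ i → f i ≤ 1) → sumℕ f ≤ m
sumℕ-bounded {zero}  f f≤1 = z≤n
sumℕ-bounded {suc m} f f≤1 = ℕₚ.+-mono-≤ (f≤1 zero) (sumℕ-bounded (f ∘ suc) (f≤1 ∘ suc))

sumℕ≡size⇒all≡1 : ∀ {m} (f : Fin m → ℕ) → (∀ i → f i ≤ 1) → sumℕ f ≡ m → ∀ i → f i ≡ 1
sumℕ≡size⇒all≡1 {suc m} f f≤1 sum≡ with f zero in f₀ | f≤1 zero
... | zero        | _      = contradiction (sumℕ-bounded (f ∘ suc) (f≤1 ∘ suc)) (ℕₚ.<⇒≱ (ℕₚ.≤-reflexive (sym sum≡)))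
... | suc zero    | _      = λ { zero    → f₀
                               ; (suc i) → sumℕ≡size⇒all≡1 (f ∘ suc) (f≤1 ∘ suc) (ℕₚ.suc-injective sum≡) i }
... | suc (suc _) | s≤s ()

count : ∀ {m} → (Fin m → Bool) → ℕ
count p = sumℕ (λ i → if p i then 1 else 0)

count-unique : ∀ {m} {p : Fin m → Bool} → UniquelyTrue p → count p ≡ 1
count-unique {p = p} u = trans (sumℕ≡sum (λ i → if p i then 1 else 0)) (sum-if-unique ℕₚ.+-0-commutativeMonoid 1 u)

count-none : ∀ {m} {p : Fin m → Bool} → (∀ i → p i ≢ true) → count p ≡ 0
count-none {zero}      none = refl
count-none {suc m} {p} none with p zero in e
... | true  = contradiction e (none zero)
... | false = count-none (none ∘ suc)

any-true? : ∀ {m} (p : Fin m → Bool) → Dec (∃ λ i → p i ≡ true)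
any-true? p = Finₚ.any? (λ i → p i Boolₚ.≟ true)

count≢0⇒∃ : ∀ {m} {p : Fin m → Bool} → count p ≢ 0 → ∃ λ i → p i ≡ true
count≢0⇒∃ {p = p} count≢0 with any-true? p
... | yes found = found
... | no  none  = contradiction (count-none (λ i pᵢ → none (i , pᵢ))) count≢0

count-≤1 : ∀ {m} {p : Fin m → Bool} → (∀ i j → p i ≡ true → p j ≡ true → i ≡ j) → count p ≤ 1
count-≤1 {p = p} atMostOne with any-true? p
... | yes (i , pᵢ) = ℕₚ.≤-reflexive (count-unique (i , pᵢ , λ j pⱼ → atMostOne j i pⱼ pᵢ))
... | no  none      = subst (_≤ 1) (sym (count-none (λ i pᵢ → none (i , pᵢ)))) z≤n

column : ∀ {a b} → EdgeSet a b → Fin b → Fin a → Bool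
column M j i = M i j

unmatched : ∀ {a b} → EdgeSet a b → Fin a → Bool
unmatched M i = not (does (any-true? (M i)))

unmatched-sound : ∀ {a b} {M : EdgeSet a b} {i j} → unmatched M i ≡ true → M i j ≢ true
unmatched-sound {M = M} {i} {j} unmatchedᵢ Mᵢⱼ =
  contradiction (trans (sym (cong not (dec-true (any-true? (M i)) (j , Mᵢⱼ)))) unmatchedᵢ) (λ ())

unmatched-complete : ∀ {a b} {M : EdgeSet a b} {i} → (∀ j → M i j ≢ true) → unmatched M i ≡ true
unmatched-complete {M = M} {i} none = cong not (dec-false (any-true? (M i)) (λ (j , Mᵢⱼ) → none j Mᵢⱼ))

module _ {a b} {E M : EdgeSet a b} (M-matching : IsMatching E M) where
  private
    row-unique = proj₁ (proj₂ M-matching)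
    column-injective = proj₂ (proj₂ M-matching)

  card-transpose : card M ≡ sumℕ (λ j → count (column M j))
  card-transpose = sumℕ-comm (λ i j → if M i j then 1 else 0)

  column-count-≤1 : ∀ j → count (column M j) ≤ 1
  column-count-≤1 j = count-≤1 (λ i i′ → column-injective i i′ j)

  card-≤ : card M ≤ b
  card-≤ = subst (_≤ b) (sym card-transpose) (sumℕ-bounded _ column-count-≤1)

  column-uniquelyTrue : CoversV M → ∀ j → UniquelyTrue (column M j)
  column-uniquelyTrue cov j = i , Mᵢⱼ , λ i′ Mᵢ′ⱼ → column-injective i′ i j Mᵢ′ⱼ Mᵢⱼ
    where
    i = proj₁ (cov j)
    Mᵢⱼ = proj₂ (cov j)

  card-coversV : CoversV M → card M ≡ b
  card-coversV cov = trans card-transpose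
    (trans (sumℕ-cong (count-unique ∘ column-uniquelyTrue cov)) (sumℕ-ones b))

  coversV-card : card M ≡ b → CoversV M
  coversV-card card≡b j = count≢0⇒∃ (λ count≡0 → ℕₚ.1+n≢0 (trans (sym (column≡1 j)) count≡0))
    where
    column≡1 = sumℕ≡size⇒all≡1 _ column-count-≤1 (trans (sym card-transpose) card≡b)

  count-unmatched : count (unmatched M) + card M ≡ a
  count-unmatched = begin
    count (unmatched M) + card M
      ≡⟨ sumℕ-distrib-+ (λ i → if unmatched M i then 1 else 0) (count ∘ M) ⟨
    sumℕ (λ i → (if unmatched M i then 1 else 0) + count (M i))
      ≡⟨ sumℕ-cong row ⟩
    sumℕ {a} (λ _ → 1)
      ≡⟨ sumℕ-ones a ⟩
    a ∎
    where
    open ≡-Reasoning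
    row : ∀ i → (if unmatched M i then 1 else 0) + count (M i) ≡ 1
    row i with any-true? (M i)
    ... | yes (j , Mᵢⱼ) = count-unique (j , Mᵢⱼ , λ j′ Mᵢⱼ′ → row-unique i j′ j Mᵢⱼ′ Mᵢⱼ)
    ... | no  none      = cong suc (count-none (λ j Mᵢⱼ → none (j , Mᵢⱼ)))

data SplitView (s t : ℕ) : Fin (s + t) → Set where
  old : ∀ v → SplitView s t (v ↑ˡ t)
  new : ∀ u → SplitView s t (s ↑ʳ u)

splitView : ∀ s t j → SplitView s t j
splitView s t j with splitAt s j | Finₚ.join-splitAt s t j
... | inj₁ v | v↑ˡt≡j = subst (SplitView s t) v↑ˡt≡j (old v)
... | inj₂ u | s↑ʳu≡j = subst (SplitView s t) s↑ʳu≡j (new u)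

module _ {n s : ℕ} where
  augE-old : ∀ (E : EdgeSet n s) i v → augE n s E i (v ↑ˡ (n ∸ s)) ≡ E i v
  augE-old E i v rewrite Finₚ.splitAt-↑ˡ s v (n ∸ s) = refl

  augE-new : ∀ (E : EdgeSet n s) i u → augE n s E i (s ↑ʳ u) ≡ true
  augE-new E i u rewrite Finₚ.splitAt-↑ʳ s (n ∸ s) u = refl

  augW-old : ∀ w k (i : Fin n) v → augW n s w k i (v ↑ˡ (n ∸ s)) ≡ w i v
  augW-old w k i v rewrite Finₚ.splitAt-↑ˡ s v (n ∸ s) = refl

  augW-new : ∀ w k (i : Fin n) u → augW n s w k i (s ↑ʳ u) ≡ k
  augW-new w k i u rewrite Finₚ.splitAt-↑ʳ s (n ∸ s) u = refl

  restrict-isMatching : ∀ {E N} → IsMatching (augE n s E) N → IsMatching E (restrict n s N)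
  restrict-isMatching (N⊆ , row-unique , column-injective) =
      (λ i v Nᵢᵥ → trans (sym (augE-old _ i v)) (N⊆ i (v ↑ˡ (n ∸ s)) Nᵢᵥ))
    , (λ i v v′ Nᵢᵥ Nᵢᵥ′ → Finₚ.↑ˡ-injective (n ∸ s) v v′ (row-unique i _ _ Nᵢᵥ Nᵢᵥ′))
    , (λ i i′ v → column-injective i i′ (v ↑ˡ (n ∸ s)))

  weight-augment : ∀ {E} w k {P} → IsMatching (augE n s E) P → CoversV P
    → weight (augW n s w k) P ≡ weight w (restrict n s P) +ℤ sumℤ {n ∸ s} (λ _ → k)
  weight-augment w k {P} P-matching P-coversV = begin
    weight (augW n s w k) P
      ≡⟨ sumℤ-cong (λ i → sumℤ-splitAt s (F i)) ⟩
    sumℤ (λ i → sumℤ (λ v → F i (v ↑ˡ (n ∸ s))) +ℤ sumℤ (λ u → F i (s ↑ʳ u)))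
      ≡⟨ sumℤ-distrib-+ (λ i → sumℤ (λ v → F i (v ↑ˡ (n ∸ s)))) (λ i → sumℤ (λ u → F i (s ↑ʳ u))) ⟩
    sumℤ (λ i → sumℤ (λ v → F i (v ↑ˡ (n ∸ s)))) +ℤ sumℤ (λ i → sumℤ (λ u → F i (s ↑ʳ u)))
      ≡⟨ cong₂ _+ℤ_ (sumℤ-cong (λ i → sumℤ-cong (λ v → cong (if P i (v ↑ˡ (n ∸ s)) then_else 0ℤ) (augW-old w k i v))))
                    (sumℤ-comm (λ i u → F i (s ↑ʳ u))) ⟩
    weight w (restrict n s P) +ℤ sumℤ (λ u → sumℤ (λ i → F i (s ↑ʳ u)))
      ≡⟨ cong (weight w (restrict n s P) +ℤ_) (sumℤ-cong new-column) ⟩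
    weight w (restrict n s P) +ℤ sumℤ {n ∸ s} (λ _ → k)
      ∎
    where
    open ≡-Reasoning
    F : Fin n → Fin (s + (n ∸ s)) → ℤ
    F i j = if P i j then augW n s w k i j else 0ℤ
    new-column : ∀ u → sumℤ (λ i → F i (s ↑ʳ u)) ≡ k
    new-column u = trans (sumℤ-cong (λ i → cong (if P i (s ↑ʳ u) then_else 0ℤ) (augW-new w k i u)))
      (sumℤ-if-unique k (column-uniquelyTrue P-matching P-coversV (s ↑ʳ u)))

dec-true⁻¹ : ∀ {A : Set} (a? : Dec A) → does a? ≡ true → A
dec-true⁻¹ (yes a) _ = a

record Enumeration {n} (p : Fin n → Bool) (m : ℕ) : Set where
  field
    index     : Fin m → Fin n
    injective : Injective _≡_ _≡_ index
    sound     : ∀ t → p (index t) ≡ true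
    complete  : ∀ i → p i ≡ true → ∃ λ t → index t ≡ i
open Enumeration

enumeration-cons : ∀ {n m} {p : Fin (suc n) → Bool} → p zero ≡ true → Enumeration (p ∘ suc) m → Enumeration p (suc m)
enumeration-cons p₀ e .index zero    = zero
enumeration-cons p₀ e .index (suc t) = suc (e .index t)
enumeration-cons p₀ e .injective {zero}  {zero}   _  = refl
enumeration-cons p₀ e .injective {suc t} {suc t′} eq = cong suc (e .injective (Finₚ.suc-injective eq))
enumeration-cons p₀ e .sound zero    = p₀
enumeration-cons p₀ e .sound (suc t) = e .sound t
enumeration-cons p₀ e .complete zero    _  = zero , refl
enumeration-cons p₀ e .complete (suc i) pᵢ = map suc (cong suc) (e .complete i pᵢ)

enumeration-skip : ∀ {n m} {p : Fin (suc n) → Bool} → p zero ≡ false → Enumeration (p ∘ suc) m → Enumeration p m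
enumeration-skip p₀ e .index    = suc ∘ e .index
enumeration-skip p₀ e .injective = e .injective ∘ Finₚ.suc-injective
enumeration-skip p₀ e .sound    = e .sound
enumeration-skip p₀ e .complete zero    p₀′ = contradiction (trans (sym p₀) p₀′) (λ ())
enumeration-skip p₀ e .complete (suc i) pᵢ  = map₂ (cong suc) (e .complete i pᵢ)

enumerate : ∀ {n} (p : Fin n → Bool) → Enumeration p (count p)
enumerate {zero}  p = record { index = λ (); injective = λ { {()} }; sound = λ (); complete = λ () }
enumerate {suc n} p with p zero in p₀
... | true  = enumeration-cons p₀ (enumerate (p ∘ suc))
... | false = enumeration-skip p₀ (enumerate (p ∘ suc))

module _ {n s} {E M : EdgeSet n s} (M-matching : IsMatching E M) (M-coversV : CoversV M) where
  private
    M⊆E = proj₁ M-matching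
    row-unique = proj₁ (proj₂ M-matching)
    column-injective = proj₂ (proj₂ M-matching)

    count-unmatched≡ : count (unmatched M) ≡ n ∸ s
    count-unmatched≡ = begin
      count (unmatched M)                ≡⟨ ℕₚ.m+n∸n≡m _ s ⟨
      count (unmatched M) + s ∸ s        ≡⟨ cong (λ c → count (unmatched M) + c ∸ s) (card-coversV M-matching M-coversV) ⟨
      count (unmatched M) + card M ∸ s   ≡⟨ cong (_∸ s) (count-unmatched M-matching) ⟩
      n ∸ s                              ∎
      where open ≡-Reasoning

    free : Enumeration (unmatched M) (n ∸ s)
    free = subst (Enumeration (unmatched M)) count-unmatched≡ (enumerate (unmatched M))

    -- The u-th free vertex of U is matched to the new vertex v_{s+1+u}.
    P-row : Fin n → Fin s ⊎ Fin (n ∸ s) → Bool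
    P-row i = [ M i , (λ u → does (free .index u ≟ i)) ]′

    P : EdgeSet n (s + (n ∸ s))
    P i j = P-row i (splitAt s j)

    P-old : ∀ i v → P i (v ↑ˡ (n ∸ s)) ≡ M i v
    P-old i v = cong (P-row i) (Finₚ.splitAt-↑ˡ s v (n ∸ s))

    P-new : ∀ i u → P i (s ↑ʳ u) ≡ does (free .index u ≟ i)
    P-new i u = cong (P-row i) (Finₚ.splitAt-↑ʳ s (n ∸ s) u)

    P-new⁻¹ : ∀ {i u} → P i (s ↑ʳ u) ≡ true → free .index u ≡ i
    P-new⁻¹ {i} {u} Pᵢᵤ = dec-true⁻¹ (free .index u ≟ i) (trans (sym (P-new i u)) Pᵢᵤ)

    P-new-true : ∀ {i u} → free .index u ≡ i → P i (s ↑ʳ u) ≡ true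
    P-new-true {i} {u} eq = trans (P-new i u) (dec-true (free .index u ≟ i) eq)

    old-new-disjoint : ∀ {i v u} → P i (v ↑ˡ (n ∸ s)) ≡ true → P i (s ↑ʳ u) ≢ true
    old-new-disjoint {i} {v} {u} Pᵢᵥ Pᵢᵤ =
      unmatched-sound {M = M} (subst (λ i → unmatched M i ≡ true) (P-new⁻¹ Pᵢᵤ) (free .sound u)) (trans (sym (P-old i v)) Pᵢᵥ)

    P⊆augE : P ⊆ₑ augE n s E
    P⊆augE i j Pᵢⱼ with splitView s (n ∸ s) j
    ... | old v = trans (augE-old E i v) (M⊆E i v (trans (sym (P-old i v)) Pᵢⱼ))
    ... | new u = augE-new E i u

    P-row-unique : ∀ i j j′ → P i j ≡ true → P i j′ ≡ true → j ≡ j′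
    P-row-unique i j j′ Pᵢⱼ Pᵢⱼ′ with splitView s (n ∸ s) j | splitView s (n ∸ s) j′
    ... | old v | old v′ = cong (_↑ˡ (n ∸ s)) (row-unique i v v′ (trans (sym (P-old i v)) Pᵢⱼ) (trans (sym (P-old i v′)) Pᵢⱼ′))
    ... | old v | new u′ = contradiction Pᵢⱼ′ (old-new-disjoint Pᵢⱼ)
    ... | new u | old v′ = contradiction Pᵢⱼ (old-new-disjoint Pᵢⱼ′)
    ... | new u | new u′ = cong (s ↑ʳ_) (free .injective (trans (P-new⁻¹ Pᵢⱼ) (sym (P-new⁻¹ Pᵢⱼ′))))

    P-column-injective : ∀ i i′ j → P i j ≡ true → P i′ j ≡ true → i ≡ i′
    P-column-injective i i′ j Pᵢⱼ Pᵢ′ⱼ with splitView s (n ∸ s) j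
    ... | old v = column-injective i i′ v (trans (sym (P-old i v)) Pᵢⱼ) (trans (sym (P-old i′ v)) Pᵢ′ⱼ)
    ... | new u = trans (sym (P-new⁻¹ Pᵢⱼ)) (P-new⁻¹ Pᵢ′ⱼ)

    P-coversU : CoversU P
    P-coversU i with any-true? (M i)
    ... | yes (v , Mᵢᵥ) = v ↑ˡ (n ∸ s) , trans (P-old i v) Mᵢᵥ
    ... | no  none      = let (u , uᵢ) = free .complete i (unmatched-complete {M = M} (λ j Mᵢⱼ → none (j , Mᵢⱼ)))
                          in s ↑ʳ u , P-new-true uᵢ

    P-coversV : CoversV P
    P-coversV j with splitView s (n ∸ s) j
    ... | old v = proj₁ (M-coversV v) , trans (P-old _ v) (proj₂ (M-coversV v))
    ... | new u = free .index u , P-new-true refl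

  extend-to-perfect : Σ (EdgeSet n (s + (n ∸ s))) λ P
    → IsPerfectMatching (augE n s E) P × (∀ i v → restrict n s P i v ≡ M i v)
  extend-to-perfect = P , ((P⊆augE , P-row-unique , P-column-injective) , P-coversU , P-coversV) , P-old

weight-cong : ∀ {a b} (w : Fin a → Fin b → ℤ) {A B : EdgeSet a b} → (∀ i j → A i j ≡ B i j) → weight w A ≡ weight w B
weight-cong w A≗B = sumℤ-cong (λ i → sumℤ-cong (λ j → cong (if_then w i j else 0ℤ) (A≗B i j)))

+ℤ-cancelʳ-≤ : ∀ {x y} z → x +ℤ z ≤ℤ y +ℤ z → x ≤ℤ y
+ℤ-cancelʳ-≤ {x} {y} z x+z≤y+z =
  subst₂ _≤ℤ_ (//-rightDividesʳ z x) (//-rightDividesʳ z y) (ℤₚ.+-monoˡ-≤ (- z) x+z≤y+z)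

augmented-minimum-≤ : ∀ {n s E} w k {N M′} → IsMinWeightPerfectMatching (augE n s E) (augW n s w k) N
  → IsMatching E M′ → CoversV M′ → weight (augW n s w k) N ≤ℤ weight w M′ +ℤ sumℤ {n ∸ s} (λ _ → k)
augmented-minimum-≤ {n} {s} w k {N} {M′} (_ , N-minimal) M′-matching M′-coversV
  with extend-to-perfect M′-matching M′-coversV
... | P , P-perfect@(P-matching , _ , P-coversV) , P-extends = begin
  weight (augW n s w k) N               ≤⟨ N-minimal P P-perfect ⟩
  weight (augW n s w k) P               ≡⟨ weight-augment w k P-matching P-coversV ⟩
  weight w (restrict n s P) +ℤ K        ≡⟨ cong (_+ℤ K) (weight-cong w P-extends) ⟩
  weight w M′ +ℤ K                      ∎
  where
  open ℤₚ.≤-Reasoning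
  K = sumℤ {n ∸ s} (λ _ → k)

mainTheorem14 : (n s : ℕ) → s ≤ n → (E : EdgeSet n s) → (w : Fin n → Fin s → ℤ) → (k : ℤ)
    → (N : EdgeSet n (s + (n ∸ s)))
    → IsMinWeightPerfectMatching (augE n s E) (augW n s w k) N
    → IsOptimumMatching E w (restrict n s N) × CoversV (restrict n s N)
mainTheorem14 n s _ E w k N N-minimum@((N-matching , _ , N-coversV) , _) =
  (M-matching , M-maximum , M-minimum) , M-coversV
  where
  M : EdgeSet n s
  M = restrict n s N
  M-matching : IsMatching E M
  M-matching = restrict-isMatching N-matching
  M-coversV : CoversV M
  M-coversV v = N-coversV (v ↑ˡ (n ∸ s))
  card-M : card M ≡ s
  card-M = card-coversV M-matching M-coversV
  M-maximum : ∀ M′ → IsMatching E M′ → card M′ ≤ card M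
  M-maximum M′ M′-matching = subst (card M′ ≤_) (sym card-M) (card-≤ M′-matching)
  M-minimum : ∀ M′ → IsMatching E M′ → card M′ ≡ card M → weight w M ≤ℤ weight w M′
  M-minimum M′ M′-matching card≡ = +ℤ-cancelʳ-≤ (sumℤ {n ∸ s} (λ _ → k))
    (subst (_≤ℤ _) (weight-augment w k N-matching N-coversV)
      (augmented-minimum-≤ w k N-minimum M′-matching (coversV-card M′-matching (trans card≡ card-M))))
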